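{- Consider a stable defeasible logic, a subset $J$ of its inference rules, and a defeasible theory $D$. Then: (1) every prefix of a proof from $D$ is a proof; (2) if $P$ and $Q$ are proofs from $D$, then their concatenation $P;Q$ is a proof; (3) if $P$ and $Q$ are proofs from $D$, then every interleaving of $P$ and $Q$ is a proof; (4) the $J$-closure of $D$ is well-defined, i.e. the $I$-inferential closure (smallest $I$-closed set of conclusions) exists, where $I$ is the smallest reference-closed set of inference rules containing $J$.
   Context: A defeasible theory $D=(F,R,>)$ consists of a finite set $F$ of literals, a finite set $R$ of rules (each with a finite antecedent set of literals, a type strict/defeasible/defeater and a consequent literal) and an acyclic relation $>$ on $R$. Conclusions have the form $+d\,q$ or $-d\,q$ ($d$ a tag, $q$ a literal). A defeasible logic consists of a language of defeasible theories and a finite set of inference rules "We may append $\pm d\,q$ to $P$ if $C$", one per tag, where the applicability condition $C=C(D,q,P)$ is a first-order condition depending on $D$, $q$, and the sequence $P$ of conclusions so far (it may contain membership tests $\pm d'p\in P$ and membership tests in pre-defined sets of conclusions). A proof from $D$ is a finite sequence of conclusions each appendable by some inference rule to the sequence preceding it. An inference rule is stable if for every proof $P$ and every proof $Q$ containing $P$ as a subsequence, $C(P)\rightarrow C(Q)$; a logic is stable if all its inference rules are. A set $I$ of inference rules is reference-closed if whenever the applicability condition of a rule in $I$ refers to membership of a conclusion with tag $t$ in the proof, the rule with tag $t$ is in $I$. A set $S$ of conclusions is $I$-closed if every conclusion that can be inferred by a rule in $I$ from a sequence of elements of $S$ is already in $S$; the $I$-inferential closure is the smallest $I$-closed set. The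 $J$-closure is the set of conclusions in the $I$-inferential closure whose tag is that of a rule in $J$, where $I$ is the smallest reference-closed set containing $J$. -}

module Defs where

open import Level using (Level; 0ℓ) renaming (suc to lsuc)
open import Data.Nat using (ℕ)
open import Data.Fin using (Fin)
open import Data.List using (List; []; _++_; _∷ʳ_)
open import Data.List.Membership.Propositional using (_∈_)
open import Data.List.Relation.Unary.All using (All)
import Data.List.Relation.Binary.Sublist.Propositional as Sub
import Data.List.Relation.Ternary.Interleaving.Propositional as Inter
open import Data.Product using (Σ; _×_)
open import Relation.Nullary using (¬_)
open import Relation.Binary.Construct.Closure.Transitive using (TransClosure)

data Literal (Atom : Set) : Set where
  pos : Atom → Literal Atom
  neg : Atom → Literal Atom

data RuleType : Set where
  strict defeasible defeater : RuleType

record Rule (Atom : Set) : Set where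
  field
    antecedent : List (Literal Atom)
    type       : RuleType
    consequent : Literal Atom

record Theory (Atom : Set) : Set₁ where
  field
    facts    : List (Literal Atom)
    rules    : List (Rule Atom)
    sup      : Rule Atom → Rule Atom → Set
    sup-on-R : ∀ r s → sup r s → (r ∈ rules) × (s ∈ rules)
    acyclic  : ∀ r → ¬ TransClosure sup r r

data Sign : Set where
  plus minus : Sign

record Conclusion (Atom : Set) (Tag : Set) : Set where
  constructor conc
  field
    sign : Sign
    tag  : Tag
    lit  : Literal Atom

-- A defeasible logic: finitely many tags (Fin nTags), one inference rule
-- per tag.  The inference rule of tag d is given by its applicability
-- condition  cond D d s q P  ("we may append s d q to P if ..."), and by
-- the set  refs d  of tags t such that the condition of rule d refers to
-- membership in the proof of a conclusion with tag t.

record DefeasibleLogic : Set₂ where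
  field
    Atom  : Set
    nTags : ℕ
    refs  : Fin nTags → Fin nTags → Set
    cond  : Theory Atom → Fin nTags → Sign → Literal Atom →
            List (Conclusion Atom (Fin nTags)) → Set

module _ (L : DefeasibleLogic) where
  open DefeasibleLogic L

  Tag : Set
  Tag = Fin nTags

  Conc : Set
  Conc = Conclusion Atom Tag

  Appendable : Theory Atom → List Conc → Conc → Set
  Appendable D P c = cond D (Conclusion.tag c) (Conclusion.sign c) (Conclusion.lit c) P

  data IsProof (D : Theory Atom) : List Conc → Set where
    []  : IsProof D []
    _▷_ : ∀ {P c} → IsProof D P → Appendable D P c → IsProof D (P ∷ʳ c)

  StableRule : Tag → Set₁
  StableRule d = ∀ (D : Theory Atom) s q (P Q : List Conc) →
    IsProof D P → IsProof D Q → P Sub.⊆ Q → cond D d s q P → cond D d s q Q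

  Stable : Set₁
  Stable = ∀ d → StableRule d

  data RefClosure (J : Tag → Set) : Tag → Set where
    base : ∀ {d} → J d → RefClosure J d
    step : ∀ {d t} → RefClosure J d → refs d t → RefClosure J t

  IClosed : Theory Atom → (Tag → Set) → (Conc → Set) → Set
  IClosed D I S = ∀ (P : List Conc) (c : Conc) →
    I (Conclusion.tag c) → All S P → Appendable D P c → S c

  InferentialClosureExists : Theory Atom → (Tag → Set) → Set₁
  InferentialClosureExists D I =
    Σ (Conc → Set) λ S → IClosed D I S ×
      (∀ (S′ : Conc → Set) → IClosed D I S′ → ∀ c → S c → S′ c)

  Interleaving : List Conc → List Conc → List Conc → Set
  Interleaving = Inter.Interleaving

module Submission where

open import Defs
open import Data.List using (List; []; _∷_; _++_; _∷ʳ_; [_])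
open import Data.List.Properties using (∷ʳ-injective; ++-assoc; ++-identityʳ)
open import Data.List.Relation.Unary.All using (All; []; _∷_)
open import Data.List.Relation.Binary.Sublist.Propositional using (_⊆_; ⊆-refl)
open import Data.List.Relation.Binary.Sublist.Propositional.Properties using (++⁺; ++⁺ʳ)
import Data.List.Relation.Binary.Pointwise as Pointwise
import Data.List.Relation.Ternary.Interleaving as Inter
open import Data.List.Relation.Ternary.Interleaving.Properties using (++-disjoint)
open import Data.Product using (_×_; _,_; proj₁)
open import Relation.Binary.PropositionalEquality using (_≡_; refl; sym; subst)

-- Stability is exactly what lets a conclusion stay appendable when the proof
-- it was appended to is embedded as a subsequence into a larger proof.  An
-- interleaving R of proofs P and Q is built by snoc-induction: each new
-- element of R was appendable to a prefix of P (or of Q), and that prefix is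
-- a subsequence of the corresponding prefix of R.  Concatenation is a special
-- interleaving, and prefix-closure needs no stability at all.  The inferential
-- closure is the inductively generated set of conclusions, which is closed by
-- construction and contained in every closed set by induction.

module _ {a} {A : Set a} where

  data SnocInterleaving : List A → List A → List A → Set a where
    []    : SnocInterleaving [] [] []
    snocˡ : ∀ {P Q R} x → SnocInterleaving P Q R → SnocInterleaving (P ∷ʳ x) Q (R ∷ʳ x)
    snocʳ : ∀ {P Q R} x → SnocInterleaving P Q R → SnocInterleaving P (Q ∷ʳ x) (R ∷ʳ x)

  swap : ∀ {P Q R} → SnocInterleaving P Q R → SnocInterleaving Q P R
  swap []          = []
  swap (snocˡ x s) = snocʳ x (swap s)
  swap (snocʳ x s) = snocˡ x (swap s)

  consˡ : ∀ {P Q R} x → SnocInterleaving P Q R → SnocInterleaving (x ∷ P) Q (x ∷ R)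
  consˡ x []          = snocˡ x []
  consˡ x (snocˡ y s) = snocˡ y (consˡ x s)
  consˡ x (snocʳ y s) = snocʳ y (consˡ x s)

  consʳ : ∀ {P Q R} x → SnocInterleaving P Q R → SnocInterleaving P (x ∷ Q) (x ∷ R)
  consʳ x s = swap (consˡ x (swap s))

  fromInterleaving : ∀ {P Q R} → Inter.Interleaving _≡_ _≡_ P Q R → SnocInterleaving P Q R
  fromInterleaving Inter.[]          = []
  fromInterleaving (refl Inter.∷ˡ i) = consˡ _ (fromInterleaving i)
  fromInterleaving (refl Inter.∷ʳ i) = consʳ _ (fromInterleaving i)

  ⊆ˡ : ∀ {P Q R} → SnocInterleaving P Q R → P ⊆ R
  ⊆ˡ []          = ⊆-refl
  ⊆ˡ (snocˡ x s) = ++⁺ (⊆ˡ s) ⊆-refl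
  ⊆ˡ (snocʳ x s) = ++⁺ʳ [ x ] (⊆ˡ s)

  ⊆ʳ : ∀ {P Q R} → SnocInterleaving P Q R → Q ⊆ R
  ⊆ʳ s = ⊆ˡ (swap s)

  ++-interleaving : ∀ (P Q : List A) → Inter.Interleaving _≡_ _≡_ P Q (P ++ Q)
  ++-interleaving P Q =
    ++-disjoint (Inter.left (Pointwise.refl refl)) (Inter.right (Pointwise.refl refl))

module _ (L : DefeasibleLogic) (D : Theory (DefeasibleLogic.Atom L)) where

  private
    Proof = IsProof L D

  unsnoc : ∀ {P c} → Proof (P ∷ʳ c) → Proof P × Appendable L D P c
  unsnoc p = go p refl
    where
    go : ∀ {R P c} → Proof R → R ≡ P ∷ʳ c → Proof P × Appendable L D P c
    go {P = []}    [] ()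
    go {P = _ ∷ _} [] ()
    go {P = P} (_▷_ {P′} p a) eq with ∷ʳ-injective P′ P eq
    ... | refl , refl = p , a

  prefix-closed : ∀ (P Q : List (Conc L)) → Proof (P ++ Q) → Proof P
  prefix-closed P []      p = subst Proof (++-identityʳ P) p
  prefix-closed P (c ∷ Q) p =
    proj₁ (unsnoc (prefix-closed (P ∷ʳ c) Q (subst Proof (sym (++-assoc P [ c ] Q)) p)))

  module _ (stable : Stable L) where

    appendable-mono : ∀ {P Q} c → Proof P → Proof Q → P ⊆ Q →
                      Appendable L D P c → Appendable L D Q c
    appendable-mono (conc s d q) = stable d D s q _ _

    interleaving-closed : ∀ {P Q R} → SnocInterleaving P Q R → Proof P → Proof Q → Proof R
    interleaving-closed []          _  _  = []
    interleaving-closed (snocˡ x s) pP pQ with unsnoc pP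
    ... | p , a = let r = interleaving-closed s p pQ in r ▷ appendable-mono x p r (⊆ˡ s) a
    interleaving-closed (snocʳ x s) pP pQ with unsnoc pQ
    ... | q , a = let r = interleaving-closed s pP q in r ▷ appendable-mono x q r (⊆ʳ s) a

    ++-closed : ∀ (P Q : List (Conc L)) → Proof P → Proof Q → Proof (P ++ Q)
    ++-closed P Q = interleaving-closed (fromInterleaving (++-interleaving P Q))

  module _ (I : Tag L → Set) where

    data Derivable : Conc L → Set where
      derive : ∀ P c → I (Conclusion.tag c) → All Derivable P → Appendable L D P c → Derivable c

    derivable-closed : IClosed L D I Derivable
    derivable-closed = derive

    module _ (S : Conc L → Set) (closed : IClosed L D I S) where
      mutual
        derivable-least : ∀ c → Derivable c → S c
        derivable-least c (derive P .c i ds a) = closed P c i (derivable-leastAll ds) a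

        derivable-leastAll : ∀ {P} → All Derivable P → All S P
        derivable-leastAll []       = []
        derivable-leastAll (d ∷ ds) = derivable-least _ d ∷ derivable-leastAll ds

    inferentialClosure-exists : InferentialClosureExists L D I
    inferentialClosure-exists = Derivable , derivable-closed , derivable-least

proposition3 : (L : DefeasibleLogic) → Stable L →
    (J : Tag L → Set) → (D : Theory (DefeasibleLogic.Atom L)) →
    (∀ (P Q : List (Conc L)) → IsProof L D (P ++ Q) → IsProof L D P)
    × (∀ (P Q : List (Conc L)) → IsProof L D P → IsProof L D Q → IsProof L D (P ++ Q))
    × (∀ (P Q R : List (Conc L)) → IsProof L D P → IsProof L D Q →
         Interleaving L P Q R → IsProof L D R)
    × InferentialClosureExists L D (RefClosure L J)
proposition3 L stable J D =
    prefix-closed L D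
  , ++-closed L D stable
  , (λ P Q R pP pQ i → interleaving-closed L D stable (fromInterleaving i) pP pQ)
  , inferentialClosure-exists L D (RefClosure L J)
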